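{- Suppose $s$, $l$, and $a$ are nonnegative integers such that $l \geq 2$, $a > s+2$, and $(a-s-1)$ divides $(l+s+1)$. Let $q=(l+s+1)/(a-s-1)$. If $b$ is an integer with $b \geq a$ and $$b \geq (l+s+1)^s\left(\binom{l+s+1}{l+1} + \binom{l+s+1}{l} q\right),$$ then $\tau_s(a,b) \geq l$.
   Context: All graphs are finite and simple. For graphs $G,H$ on disjoint vertex sets, the join $G \vee H$ is the graph consisting of $G$, $H$, and all edges joining a vertex of $G$ to a vertex of $H$; $K_n$ is the complete graph on $n$ vertices, and $K_0 \vee G$ is understood as $G$. $K_{a,b}$ is the complete bipartite graph with partite sets of sizes $a$ and $b$. $\chi$ denotes chromatic number and $\chi_\ell$ list chromatic number. For a nonnegative integer $s$ and positive integers $a \le b$, $\tau_s(a,b)$ denotes the smallest nonnegative integer $n$ such that $\chi_\ell(K_n \vee K_{a,b}) - \chi(K_n \vee K_{a,b}) \leq s$. -}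

module Defs where

open import Level using (0ℓ)
open import Data.Nat using (ℕ; _≤_; _∸_)
open import Data.Fin using (Fin)
open import Data.Sum using (_⊎_; inj₁; inj₂)
open import Data.Product using (Σ; ∃; ∃₂; _×_)
open import Data.Empty using (⊥)
open import Data.Unit using (⊤)
open import Data.List using (List; length)
open import Data.List.Membership.Propositional using (_∈_)
open import Data.List.Relation.Unary.Unique.Propositional using (Unique)
open import Relation.Binary.PropositionalEquality using (_≡_; _≢_)

record Graph : Set₁ where
  field
    V   : Set
    Adj : V → V → Set
open Graph public

K : ℕ → Graph
K n = record { V = Fin n ; Adj = λ i j → i ≢ j }

KBip : ℕ → ℕ → Graph
KBip a b = record { V = Fin a ⊎ Fin b ; Adj = adj }
  where
  adj : Fin a ⊎ Fin b → Fin a ⊎ Fin b → Set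
  adj (inj₁ _) (inj₂ _) = ⊤
  adj (inj₂ _) (inj₁ _) = ⊤
  adj _ _ = ⊥

_∨G_ : Graph → Graph → Graph
G ∨G H = record { V = V G ⊎ V H ; Adj = adj }
  where
  adj : V G ⊎ V H → V G ⊎ V H → Set
  adj (inj₁ x) (inj₁ y) = Adj G x y
  adj (inj₂ x) (inj₂ y) = Adj H x y
  adj (inj₁ _) (inj₂ _) = ⊤
  adj (inj₂ _) (inj₁ _) = ⊤

Proper : (G : Graph) {C : Set} → (V G → C) → Set
Proper G c = ∀ u v → Adj G u v → c u ≢ c v

Colorable : Graph → ℕ → Set
Colorable G k = Σ (V G → Fin k) (Proper G)

IsChromaticNumber : Graph → ℕ → Set
IsChromaticNumber G k = Colorable G k × (∀ j → Colorable G j → k ≤ j)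

Choosable : Graph → ℕ → Set
Choosable G k =
  (L : V G → List ℕ) →
  (∀ v → Unique (L v)) →
  (∀ v → k ≤ length (L v)) →
  Σ (V G → ℕ) (λ c → (∀ v → c v ∈ L v) × Proper G c)

IsListChromaticNumber : Graph → ℕ → Set
IsListChromaticNumber G k = Choosable G k × (∀ j → Choosable G j → k ≤ j)

GapAtMost : (s n a b : ℕ) → Set
GapAtMost s n a b =
  ∃₂ λ χ χℓ → IsChromaticNumber (K n ∨G KBip a b) χ
            × IsListChromaticNumber (K n ∨G KBip a b) χℓ
            × χℓ ∸ χ ≤ s

IsTau : (s a b t : ℕ) → Set
IsTau s a b t = GapAtMost s t a b × (∀ n → GapAtMost s n a b → t ≤ n)

{-# OPTIONS --safe #-}
module Submission where

-- Suppose n < l and write N = l + s + 1 = q p with p = a - s - 1. Since χ(K_n ∨ K_{a,b}) ≤ n + 2, a gap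
-- of at most s makes K_n ∨ K_{a,b} (n+s+2)-choosable, and each further clique vertex costs one more
-- colour, so K_{l-1} ∨ K_{a,b} would be N-choosable. An explicit assignment of N-lists refutes this.
-- The clique gets the core colours [0, N), cut into p blocks of q colours. On the side of size
-- a = s + 1 + p, s vertices get pairwise disjoint private blocks of N colours, one vertex gets the core,
-- and for each j < p one vertex gets the core with block j replaced by q extra colours. On the side of
-- size b, for every choice of one colour from each private block, we put every (l+1)-subset of the
-- core and every l-subset plus one extra colour: N^s (C(N,l+1) + C(N,l) q) ≤ b lists in all.
-- In a colouring from these lists the core vertex gets a colour c₀ outside the l - 1 clique colours,
-- and the vertex whose list avoids the block of c₀ gets an extra colour or a core colour other than c₀.
-- Either way some list on the b-side consists of colours of its neighbours only.

open import Defs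
open import Data.Nat using (ℕ; _+_; _*_; _∸_; _^_; _≤_; _<_)
open import Data.Nat.Combinatorics using (_C_)
open import Relation.Binary.PropositionalEquality using (_≡_)

open import Data.Nat using (_≟_; zero; suc; z≤n; s≤s; z<s; s<s; _≤‴_; ≤‴-refl; ≤‴-step; NonZero; >-nonZero)
open import Data.Nat.Properties
open import Data.Nat.DivMod using (_/_; _%_; m≡m%n+[m/n]*n; m%n<n; m<n*o⇒m/o<n)
open import Data.Nat.Combinatorics using (nCk+nC[k+1]≡[n+1]C[k+1])
open import Data.Nat.Solver using (module +-*-Solver)
open import Data.Fin using (Fin; zero; suc; toℕ; fromℕ<; join; splitAt)
open import Data.Fin.Properties as Fin using (toℕ-fromℕ<; splitAt-join)
open import Data.List using (List; []; _∷_; [_]; _++_; length; map; filter; tabulate; applyUpTo; upTo; cartesianProductWith)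
open import Data.List.Properties using (length-++; length-map; length-tabulate; length-applyUpTo; length-upTo; filter-all)
open import Data.List.Membership.Propositional using (_∈_)
open import Data.List.Membership.Propositional.Properties
  using (∈-++⁺ˡ; ∈-++⁺ʳ; ∈-++⁻; ∈-map⁺; ∈-map⁻; ∈-filter⁻; ∈-applyUpTo⁺; ∈-applyUpTo⁻;
         ∈-upTo⁺; ∈-upTo⁻; ∈-cartesianProductWith⁺; ∈-cartesianProductWith⁻)
open import Data.List.Relation.Binary.Subset.Propositional using (_⊆_)
open import Data.List.Relation.Binary.Subset.Propositional.Properties using (∷⁺ʳ; ∈-∷⁺ʳ)
open import Data.List.Relation.Unary.Any using (here; there)
open import Data.List.Relation.Unary.All as All using (All; []; _∷_)
open import Data.List.Relation.Unary.All.Properties using (++⁺; tabulate⁺)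
open import Data.List.Relation.Unary.AllPairs using ([]; _∷_)
open import Data.List.Relation.Unary.Unique.Propositional using (Unique)
open import Data.List.Relation.Unary.Unique.Propositional.Properties as Unique using (upTo⁺; applyUpTo⁺₁; filter⁺)
open import Data.Product using (∃; _×_; _,_; proj₁; proj₂)
open import Data.Sum using (_⊎_; inj₁; inj₂; [_,_]′)
import Data.Sum as Sum
open import Data.Sum.Properties using (inj₁-injective; inj₂-injective)
open import Data.Unit using (tt)
open import Function using (_∘_; id; const)
open import Relation.Binary.Definitions using (DecidableEquality)
open import Relation.Binary.PropositionalEquality using (refl; sym; trans; cong; cong₂; subst; _≢_; module ≡-Reasoning)
open import Relation.Nullary using (¬_; yes; no; ¬?; contradiction)
open import Relation.Nullary.Decidable using (decidable-stable)

private
  variable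
    A B X : Set

m+[1+[n∸m∸1]]≡n : ∀ {m n} → m < n → m + suc (n ∸ m ∸ 1) ≡ n
m+[1+[n∸m∸1]]≡n {m} m<n = trans (cong (m +_) (m+[n∸m]≡n (m<n⇒0<n∸m m<n))) (m+[n∸m]≡n (<⇒≤ m<n))

/-%-injective : ∀ {m n} d .{{_ : NonZero d}} → m % d ≡ n % d → m / d ≡ n / d → m ≡ n
/-%-injective {m} {n} d m%d≡n%d m/d≡n/d = begin
  m                 ≡⟨ m≡m%n+[m/n]*n m d ⟩
  m % d + m / d * d ≡⟨ cong₂ (λ r k → r + k * d) m%d≡n%d m/d≡n/d ⟩
  n % d + n / d * d ≡⟨ sym (m≡m%n+[m/n]*n n d) ⟩
  n                 ∎
  where open ≡-Reasoning

interval : ℕ → ℕ → List ℕ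
interval i n = applyUpTo (i +_) n

∈-interval⁻ : ∀ {i n x} → x ∈ interval i n → i ≤ x × x < i + n
∈-interval⁻ {i} x∈ with j , j<n , refl ← ∈-applyUpTo⁻ (i +_) x∈ = m≤m+n i j , +-monoʳ-< i j<n

interval-unique : ∀ i n → Unique (interval i n)
interval-unique i n = applyUpTo⁺₁ (i +_) n (λ j<k _ → <⇒≢ (+-monoʳ-< i j<k))

++⁺-separated : ∀ {t xs ys} → Unique xs → Unique ys → All (_< t) xs → All (t ≤_) ys → Unique (xs ++ ys)
++⁺-separated uxs uys xs<t t≤ys =
  Unique.++⁺ uxs uys λ (v∈xs , v∈ys) → <⇒≱ (All.lookup xs<t v∈xs) (All.lookup t≤ys v∈ys)

length-cartesianProductWith : ∀ (f : A → B → X) xs ys →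
  length (cartesianProductWith f xs ys) ≡ length xs * length ys
length-cartesianProductWith f []       ys = refl
length-cartesianProductWith f (x ∷ xs) ys = begin
  length (map (f x) ys ++ cartesianProductWith f xs ys)          ≡⟨ length-++ (map (f x) ys) ⟩
  length (map (f x) ys) + length (cartesianProductWith f xs ys)  ≡⟨ cong₂ _+_ (length-map (f x) ys)
                                                                        (length-cartesianProductWith f xs ys) ⟩
  length ys + length xs * length ys                              ∎
  where open ≡-Reasoning

lookupOr : A → List A → ℕ → A
lookupOr d []       _       = d
lookupOr d (x ∷ xs) zero    = x
lookupOr d (x ∷ xs) (suc i) = lookupOr d xs i

∈⇒lookupOr : ∀ {d x} {xs : List A} → x ∈ xs → ∃ λ i → i < length xs × lookupOr d xs i ≡ x
∈⇒lookupOr (here refl) = zero , z<s , refl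
∈⇒lookupOr (there x∈xs) with i , i<n , eq ← ∈⇒lookupOr x∈xs = suc i , s<s i<n , eq

lookupOr-All : ∀ {P : A → Set} {d xs} → P d → All P xs → ∀ i → P (lookupOr d xs i)
lookupOr-All pd []         _       = pd
lookupOr-All pd (px ∷ _)   zero    = px
lookupOr-All pd (_ ∷ pxs)  (suc i) = lookupOr-All pd pxs i

combinations : ℕ → List A → List (List A)
combinations zero    _        = [ [] ]
combinations (suc k) []       = []
combinations (suc k) (x ∷ xs) = map (x ∷_) (combinations k xs) ++ combinations (suc k) xs

length-combinations : ∀ k (xs : List A) → length (combinations k xs) ≡ length xs C k
length-combinations zero    xs       = refl
length-combinations (suc k) []       = refl
length-combinations (suc k) (x ∷ xs) = begin
  length (combinations (suc k) (x ∷ xs))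
    ≡⟨ length-++ (map _ (combinations k xs)) ⟩
  length (map _ (combinations k xs)) + length (combinations (suc k) xs)
    ≡⟨ cong (_+ _) (length-map _ (combinations k xs)) ⟩
  length (combinations k xs) + length (combinations (suc k) xs)
    ≡⟨ cong₂ _+_ (length-combinations k xs) (length-combinations (suc k) xs) ⟩
  length xs C k + length xs C suc k
    ≡⟨ nCk+nC[k+1]≡[n+1]C[k+1] (length xs) k ⟩
  suc (length xs) C suc k
    ∎
  where open ≡-Reasoning

∈-combinations⁻ : ∀ {k} {xs S : List A} → S ∈ combinations k xs → S ⊆ xs × length S ≡ k
∈-combinations⁻ {k = zero} (here refl) = (λ ()) , refl
∈-combinations⁻ {k = suc k} {x ∷ xs} S∈ with ∈-++⁻ (map _ (combinations k xs)) S∈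
... | inj₂ S∈′ = let S⊆xs , |S|≡k = ∈-combinations⁻ S∈′ in there ∘ S⊆xs , |S|≡k
... | inj₁ S∈′ with S′ , S′∈ , refl ← ∈-map⁻ (x ∷_) S∈′ =
  let S′⊆xs , |S′|≡k = ∈-combinations⁻ S′∈ in ∷⁺ʳ x S′⊆xs , cong suc |S′|≡k

combinations-unique : ∀ {k} {xs S : List A} → Unique xs → S ∈ combinations k xs → Unique S
combinations-unique {k = zero} _ (here refl) = []
combinations-unique {k = suc k} {x ∷ xs} (x∉xs ∷ uxs) S∈ with ∈-++⁻ (map _ (combinations k xs)) S∈
... | inj₂ S∈′ = combinations-unique {k = suc k} uxs S∈′
... | inj₁ S∈′ with S′ , S′∈ , refl ← ∈-map⁻ (x ∷_) S∈′ =
  All.tabulate (All.lookup x∉xs ∘ proj₁ (∈-combinations⁻ {k = k} S′∈)) ∷ combinations-unique {k = k} uxs S′∈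

module WithDecidableEquality {A : Set} (_≟_ : DecidableEquality A) where

  open import Data.List.Membership.DecPropositional _≟_ using (_∈?_)

  remove : A → List A → List A
  remove x = filter (λ y → ¬? (y ≟ x))

  ∈-remove⁻ : ∀ {x y xs} → y ∈ remove x xs → y ∈ xs × y ≢ x
  ∈-remove⁻ = ∈-filter⁻ (λ y → ¬? (y ≟ _))

  remove-unique : ∀ {x xs} → Unique xs → Unique (remove x xs)
  remove-unique = filter⁺ (λ y → ¬? (y ≟ _))

  length-remove : ∀ {x xs} → Unique xs → length xs ≤ suc (length (remove x xs))
  length-remove {x} {[]}     _ = z≤n
  length-remove {x} {y ∷ ys} (y∉ys ∷ uys) with y ≟ x
  ... | yes refl = ≤-reflexive (cong (suc ∘ length) (sym (filter-all (λ z → ¬? (z ≟ x)) (All.map (_∘ sym) y∉ys))))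
  ... | no  _    = s≤s (length-remove uys)

  combinations-complete : ∀ {U} xs k → Unique U → U ⊆ xs → k ≤ length U →
                          ∃ λ S → S ∈ combinations k xs × S ⊆ U
  combinations-complete xs zero _ _ _ = [] , here refl , λ ()
  combinations-complete {[]} [] (suc k) _ _ ()
  combinations-complete {_ ∷ _} [] (suc k) _ U⊆[] _ = contradiction (U⊆[] (here refl)) λ ()
  combinations-complete {U} (x ∷ xs) (suc k) uU U⊆x∷xs k<|U| with x ∈? U
  ... | yes x∈U =
    let S , S∈ , S⊆ = combinations-complete xs k (remove-unique uU) U′⊆xs (≤-pred (≤-trans k<|U| (length-remove uU)))
    in x ∷ S , ∈-++⁺ˡ (∈-map⁺ (x ∷_) S∈) , ∈-∷⁺ʳ x∈U (proj₁ ∘ ∈-remove⁻ ∘ S⊆)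
    where
    U′⊆xs : remove x U ⊆ xs
    U′⊆xs y∈ with ∈-remove⁻ y∈
    ... | y∈U , y≢x with U⊆x∷xs y∈U
    ...   | here y≡x = contradiction y≡x y≢x
    ...   | there y∈xs = y∈xs
  ... | no x∉U =
    let S , S∈ , S⊆ = combinations-complete xs (suc k) uU U⊆xs k<|U|
    in S , ∈-++⁺ʳ _ S∈ , S⊆
    where
    U⊆xs : U ⊆ xs
    U⊆xs y∈U with U⊆x∷xs y∈U
    ... | here refl = contradiction y∈U x∉U
    ... | there y∈xs = y∈xs

open WithDecidableEquality _≟_

transversals : (w base : ℕ) → ℕ → List (List ℕ)
transversals w base zero    = [ [] ]
transversals w base (suc s) = cartesianProductWith _∷_ (interval base w) (transversals w (base + w) s)

length-transversals : ∀ w base s → length (transversals w base s) ≡ w ^ s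
length-transversals w base zero    = refl
length-transversals w base (suc s) = begin
  length (transversals w base (suc s))
    ≡⟨ length-cartesianProductWith _∷_ (interval base w) _ ⟩
  length (interval base w) * length (transversals w (base + w) s)
    ≡⟨ cong₂ _*_ (length-applyUpTo (base +_) w) (length-transversals w (base + w) s) ⟩
  w * w ^ s
    ∎
  where open ≡-Reasoning

∈-transversals⁻ : ∀ {w base s T} → T ∈ transversals w base s → Unique T × All (base ≤_) T × length T ≡ s
∈-transversals⁻ {s = zero} (here refl) = [] , [] , refl
∈-transversals⁻ {w} {base} {suc s} T∈
  with x , T′ , x∈ , T′∈ , refl ← ∈-cartesianProductWith⁻ _∷_ (interval base w) _ T∈ =
  let base≤x , x<base+w = ∈-interval⁻ x∈
      uT′ , base+w≤T′ , |T′|≡s = ∈-transversals⁻ T′∈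
  in ++⁺-separated {xs = [ x ]} ([] ∷ []) uT′ (x<base+w ∷ []) base+w≤T′ ,
     base≤x ∷ All.map (≤-trans (m≤m+n base w)) base+w≤T′ ,
     cong suc |T′|≡s

transversals-complete : ∀ {w base s} (f : Fin s → ℕ) → (∀ k → f k ∈ interval (base + toℕ k * w) w) →
                        tabulate f ∈ transversals w base s
transversals-complete {s = zero}  f f∈ = here refl
transversals-complete {w} {base} {suc s} f f∈ = ∈-cartesianProductWith⁺ _∷_
  (subst (λ i → f zero ∈ interval i w) (+-identityʳ base) (f∈ zero))
  (transversals-complete (f ∘ suc) λ k →
    subst (λ i → f (suc k) ∈ interval i w) (sym (+-assoc base w (toℕ k * w))) (f∈ (suc k)))

Colorable-K : ∀ n → Colorable (K n) n
Colorable-K n = id , λ _ _ i≢j → i≢j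

Colorable-KBip : ∀ a b → Colorable (KBip a b) 2
Colorable-KBip a b = [ const zero , const (suc zero) ]′ , proper
  where
  proper : Proper (KBip a b) [ const zero , const (suc zero) ]′
  proper (inj₁ _) (inj₁ _) ()
  proper (inj₁ _) (inj₂ _) _ ()
  proper (inj₂ _) (inj₁ _) _ ()
  proper (inj₂ _) (inj₂ _) ()

Colorable-∨ : ∀ {G H k l} → Colorable G k → Colorable H l → Colorable (G ∨G H) (k + l)
Colorable-∨ {G} {H} {k} {l} (c , c-proper) (d , d-proper) = colour , proper
  where
  colour : V G ⊎ V H → Fin (k + l)
  colour = join k l ∘ Sum.map c d

  join-injective : ∀ {u v} → join k l u ≡ join k l v → u ≡ v
  join-injective {u} {v} eq = begin
    u                      ≡⟨ sym (splitAt-join k l u) ⟩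
    splitAt k (join k l u) ≡⟨ cong (splitAt k) eq ⟩
    splitAt k (join k l v) ≡⟨ splitAt-join k l v ⟩
    v                      ∎
    where open ≡-Reasoning

  proper : Proper (G ∨G H) colour
  proper (inj₁ x) (inj₁ y) adj eq = c-proper x y adj (inj₁-injective (join-injective eq))
  proper (inj₂ x) (inj₂ y) adj eq = d-proper x y adj (inj₂-injective (join-injective eq))
  proper (inj₁ x) (inj₂ y) _   eq with () ← join-injective {inj₁ (c x)} {inj₂ (d y)} eq
  proper (inj₂ x) (inj₁ y) _   eq with () ← join-injective {inj₂ (d x)} {inj₁ (c y)} eq

Choosable-mono : ∀ {G k l} → k ≤ l → Choosable G k → Choosable G l
Choosable-mono k≤l ch L unique long = ch L unique (≤-trans k≤l ∘ long)

Choosable-K-suc : ∀ {n k} H → Choosable (K n ∨G H) k → Choosable (K (suc n) ∨G H) (suc k)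
Choosable-K-suc {n} H ch L unique long = colour , colour∈ , proper
  where
  first : ∀ xs → 1 ≤ length xs → ∃ (_∈ xs)
  first (x ∷ _) _ = x , here refl

  picked : ∃ (_∈ L (inj₁ zero))
  picked = first (L (inj₁ zero)) (≤-trans (s≤s z≤n) (long (inj₁ zero)))

  c₀ : ℕ
  c₀ = proj₁ picked

  old : V (K n ∨G H) → V (K (suc n) ∨G H)
  old = Sum.map₁ suc

  L′ : V (K n ∨G H) → List ℕ
  L′ v = remove c₀ (L (old v))

  rest : ∃ λ c′ → (∀ v → c′ v ∈ L′ v) × Proper (K n ∨G H) c′
  rest = ch L′ (remove-unique ∘ unique ∘ old) (λ v → ≤-pred (≤-trans (long (old v)) (length-remove (unique (old v)))))

  c′ : V (K n ∨G H) → ℕ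
  c′ = proj₁ rest

  c′-proper : Proper (K n ∨G H) c′
  c′-proper = proj₂ (proj₂ rest)

  c′∈ : ∀ v → c′ v ∈ L (old v) × c′ v ≢ c₀
  c′∈ v = ∈-remove⁻ (proj₁ (proj₂ rest) v)

  fresh : ∀ v → c′ v ≢ c₀
  fresh = proj₂ ∘ c′∈

  colour : V (K (suc n) ∨G H) → ℕ
  colour (inj₁ zero)    = c₀
  colour (inj₁ (suc i)) = c′ (inj₁ i)
  colour (inj₂ h)       = c′ (inj₂ h)

  colour∈ : ∀ v → colour v ∈ L v
  colour∈ (inj₁ zero)    = proj₂ picked
  colour∈ (inj₁ (suc i)) = proj₁ (c′∈ (inj₁ i))
  colour∈ (inj₂ h)       = proj₁ (c′∈ (inj₂ h))

  proper : Proper (K (suc n) ∨G H) colour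
  proper (inj₁ zero)    (inj₁ zero)    adj = contradiction refl adj
  proper (inj₁ zero)    (inj₁ (suc j)) _   = fresh (inj₁ j) ∘ sym
  proper (inj₁ zero)    (inj₂ h)       _   = fresh (inj₂ h) ∘ sym
  proper (inj₁ (suc i)) (inj₁ zero)    _   = fresh (inj₁ i)
  proper (inj₂ h)       (inj₁ zero)    _   = fresh (inj₂ h)
  proper (inj₁ (suc i)) (inj₁ (suc j)) adj = c′-proper (inj₁ i) (inj₁ j) (adj ∘ cong suc)
  proper (inj₁ (suc i)) (inj₂ h)       _   = c′-proper (inj₁ i) (inj₂ h) tt
  proper (inj₂ h)       (inj₁ (suc j)) _   = c′-proper (inj₂ h) (inj₁ j) tt
  proper (inj₂ h)       (inj₂ h′)      adj = c′-proper (inj₂ h) (inj₂ h′) adj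

Choosable-K-≤‴ : ∀ {n n′ r} H → n ≤‴ n′ → Choosable (K n ∨G H) (n + r) → Choosable (K n′ ∨G H) (n′ + r)
Choosable-K-≤‴ H ≤‴-refl         ch = ch
Choosable-K-≤‴ H (≤‴-step n<‴n′) ch = Choosable-K-≤‴ H n<‴n′ (Choosable-K-suc H ch)

GapAtMost⇒Choosable : ∀ {s n a b} → GapAtMost s n a b → Choosable (K n ∨G KBip a b) (n + (2 + s))
GapAtMost⇒Choosable {s} {n} {a} {b} (χ , χℓ , (_ , χ-least) , (χℓ-choosable , _) , χℓ∸χ≤s) =
  Choosable-mono χℓ≤ χℓ-choosable
  where
  colourable : Colorable (K n ∨G KBip a b) (n + 2)
  colourable = Colorable-∨ (Colorable-K n) (Colorable-KBip a b)

  χℓ≤ : χℓ ≤ n + (2 + s)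
  χℓ≤ = begin
    χℓ             ≤⟨ m≤n+m∸n χℓ χ ⟩
    χ + (χℓ ∸ χ)   ≤⟨ +-mono-≤ (χ-least (n + 2) colourable) χℓ∸χ≤s ⟩
    n + 2 + s      ≡⟨ +-assoc n 2 s ⟩
    n + (2 + s)    ∎
    where open ≤-Reasoning

module BadListAssignment (m s p q : ℕ) (N≡qp : suc m + s + 1 ≡ q * p) where

  N : ℕ
  N = suc m + s + 1

  instance
    q-nonZero : NonZero q
    q-nonZero = m*n≢0⇒m≢0 q {{>-nonZero (subst (0 <_) N≡qp z<s)}}

  core extras : List ℕ
  core   = upTo N
  extras = interval N q

  Admissible : List ℕ → Set
  Admissible xs = Unique xs × N ≤ length xs

  core-Admissible : Admissible core
  core-Admissible = upTo⁺ N , ≤-reflexive (sym (length-upTo N))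

  tailBlock : Fin s → List ℕ
  tailBlock k = interval (N + q + toℕ k * N) N

  -- Block j of the core is {x | x / q ≡ j}; avoiding j trades it for the extras.
  recolour : ℕ → ℕ → ℕ
  recolour j x with x / q ≟ j
  ... | yes _ = N + x % q
  ... | no  _ = x

  avoiding : ℕ → List ℕ
  avoiding j = applyUpTo (recolour j) N

  recolour-injective : ∀ j {x y} → x < N → y < N → recolour j x ≡ recolour j y → x ≡ y
  recolour-injective j {x} {y} x<N y<N eq with x / q ≟ j | y / q ≟ j
  ... | yes x/q≡j | yes y/q≡j = /-%-injective q (+-cancelˡ-≡ N _ _ eq) (trans x/q≡j (sym y/q≡j))
  ... | yes _     | no  _     = contradiction (subst (_< N) (sym eq) y<N) (m+n≮m N _)
  ... | no  _     | yes _     = contradiction (subst (_< N) eq x<N) (m+n≮m N _)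
  ... | no  _     | no  _     = eq

  avoiding-unique : ∀ j → Unique (avoiding j)
  avoiding-unique j = applyUpTo⁺₁ (recolour j) N λ x<y y<N → <⇒≢ x<y ∘ recolour-injective j (<-trans x<y y<N) y<N

  ∈-avoiding⁻ : ∀ {j y} → y ∈ avoiding j → y ∈ extras ⊎ (y ∈ core × y / q ≢ j)
  ∈-avoiding⁻ {j} y∈ with ∈-applyUpTo⁻ (recolour j) y∈
  ... | x , x<N , refl with x / q ≟ j
  ...   | yes _      = inj₁ (∈-applyUpTo⁺ (N +_) (m%n<n x q))
  ...   | no x/q≢j   = inj₂ (∈-upTo⁺ x<N , x/q≢j)

  heads : List (List ℕ)
  heads = combinations (suc m + 1) core
       ++ cartesianProductWith (λ S z → S ++ [ z ]) (combinations (suc m) core) extras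

  bLists : List (List ℕ)
  bLists = cartesianProductWith (λ T H → H ++ T) (transversals N (N + q) s) heads

  length-bLists : length bLists ≡ N ^ s * (N C (suc m + 1) + (N C suc m) * q)
  length-bLists = begin
    length bLists
      ≡⟨ length-cartesianProductWith _ (transversals N (N + q) s) heads ⟩
    length (transversals N (N + q) s) * length heads
      ≡⟨ cong₂ _*_ (length-transversals N (N + q) s) length-heads ⟩
    N ^ s * (N C (suc m + 1) + (N C suc m) * q)
      ∎
    where
    open ≡-Reasoning
    length-core-combinations : ∀ k → length (combinations k core) ≡ N C k
    length-core-combinations k = trans (length-combinations k core) (cong (_C k) (length-upTo N))
    length-heads : length heads ≡ N C (suc m + 1) + (N C suc m) * q
    length-heads = trans (length-++ (combinations (suc m + 1) core))
      (cong₂ _+_ (length-core-combinations (suc m + 1))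
        (trans (length-cartesianProductWith _ (combinations (suc m) core) extras)
          (cong₂ _*_ (length-core-combinations (suc m)) (length-applyUpTo (N +_) q))))

  ∈-core-combinations⁻ : ∀ {k S} → S ∈ combinations k core → Unique S × All (_< N) S × length S ≡ k
  ∈-core-combinations⁻ {k} S∈ =
    let S⊆core , |S|≡k = ∈-combinations⁻ S∈
    in combinations-unique {k = k} (upTo⁺ N) S∈ , All.tabulate (∈-upTo⁻ ∘ S⊆core) , |S|≡k

  ∈-heads⁻ : ∀ {H} → H ∈ heads → Unique H × All (_< N + q) H × length H ≡ suc m + 1
  ∈-heads⁻ H∈ with ∈-++⁻ (combinations (suc m + 1) core) H∈
  ... | inj₁ H∈₁ =
    let uH , H<N , |H| = ∈-core-combinations⁻ H∈₁
    in uH , All.map (λ x<N → <-≤-trans x<N (m≤m+n N q)) H<N , |H|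
  ... | inj₂ H∈₂
    with S , z , S∈ , z∈ , refl ← ∈-cartesianProductWith⁻ _ (combinations (suc m) core) extras H∈₂ =
    let uS , S<N , |S| = ∈-core-combinations⁻ S∈
        N≤z , z<N+q    = ∈-interval⁻ z∈
    in ++⁺-separated uS ([] ∷ []) S<N (N≤z ∷ []) ,
       ++⁺ (All.map (λ x<N → <-≤-trans x<N (m≤m+n N q)) S<N) (z<N+q ∷ []) ,
       trans (length-++ S) (cong (_+ 1) |S|)

  ∈-bLists⇒Admissible : ∀ {D} → D ∈ bLists → Admissible D
  ∈-bLists⇒Admissible D∈
    with T , H , T∈ , H∈ , refl ← ∈-cartesianProductWith⁻ _ (transversals N (N + q) s) heads D∈ =
    let uT , N+q≤T , |T| = ∈-transversals⁻ T∈
        uH , H<N+q , |H| = ∈-heads⁻ H∈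
    in ++⁺-separated uH uT H<N+q N+q≤T , ≤-reflexive (begin
      suc m + s + 1           ≡⟨ +-assoc (suc m) s 1 ⟩
      suc m + (s + 1)         ≡⟨ cong (suc m +_) (+-comm s 1) ⟩
      suc m + (1 + s)         ≡⟨ sym (+-assoc (suc m) 1 s) ⟩
      suc m + 1 + s           ≡⟨ sym (cong₂ _+_ |H| |T|) ⟩
      length H + length T     ≡⟨ sym (length-++ H) ⟩
      length (H ++ T)         ∎)
    where open ≡-Reasoning

  aLists : Fin s ⊎ Fin (suc p) → List ℕ
  aLists (inj₁ k)       = tailBlock k
  aLists (inj₂ zero)    = core
  aLists (inj₂ (suc j)) = avoiding (toℕ j)

  G : ℕ → Graph
  G b = K m ∨G KBip (s + suc p) b

  lists : ∀ {b} → V (G b) → List ℕ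
  lists (inj₁ _)        = core
  lists (inj₂ (inj₁ i)) = aLists (splitAt s i)
  lists (inj₂ (inj₂ k)) = lookupOr core bLists (toℕ k)

  lists-Admissible : ∀ {b} (v : V (G b)) → Admissible (lists v)
  lists-Admissible (inj₁ _)        = core-Admissible
  lists-Admissible (inj₂ (inj₁ i)) = aLists-Admissible (splitAt s i)
    where
    aLists-Admissible : ∀ u → Admissible (aLists u)
    aLists-Admissible (inj₁ k)       = interval-unique _ N , ≤-reflexive (sym (length-applyUpTo (N + q + toℕ k * N +_) N))
    aLists-Admissible (inj₂ zero)    = core-Admissible
    aLists-Admissible (inj₂ (suc j)) = avoiding-unique (toℕ j) , ≤-reflexive (sym (length-applyUpTo (recolour (toℕ j)) N))
  lists-Admissible (inj₂ (inj₂ k)) =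
    lookupOr-All core-Admissible (All.tabulate ∈-bLists⇒Admissible) (toℕ k)

  bLists-realised : ∀ {b} → length bLists ≤ b → ∀ {D} → D ∈ bLists →
                    ∃ λ (k : Fin b) → lists {b} (inj₂ (inj₂ k)) ≡ D
  bLists-realised |bLists|≤b D∈ with i , i<|bLists| , lookup≡D ← ∈⇒lookupOr {d = core} D∈ =
    fromℕ< (≤-trans i<|bLists| |bLists|≤b) , trans (cong (lookupOr core bLists) (toℕ-fromℕ< _)) lookup≡D

  module Colouring {b} (c : V (G b) → ℕ) (c∈ : ∀ v → c v ∈ lists v) (proper : Proper (G b) c) where

    Used : ℕ → Set
    Used x = (∃ λ i → c (inj₁ i) ≡ x) ⊎ (∃ λ i → c (inj₂ (inj₁ i)) ≡ x)

    B-blocked : ∀ k → ¬ All Used (lists (inj₂ (inj₂ k)))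
    B-blocked k used with All.lookup used (c∈ (inj₂ (inj₂ k)))
    ... | inj₁ (i , eq) = proper (inj₁ i) (inj₂ (inj₂ k)) tt eq
    ... | inj₂ (i , eq) = proper (inj₂ (inj₁ i)) (inj₂ (inj₂ k)) tt eq

    cliqueColours : List ℕ
    cliqueColours = tabulate (c ∘ inj₁)

    cliqueColours-unique : Unique cliqueColours
    cliqueColours-unique = Unique.tabulate⁺ λ {i} {j} eq →
      decidable-stable (i Fin.≟ j) λ i≢j → proper (inj₁ i) (inj₁ j) i≢j eq

    aColour : Fin s ⊎ Fin (suc p) → ℕ
    aColour u = c (inj₂ (inj₁ (join s (suc p) u)))

    aColour∈ : ∀ u → aColour u ∈ aLists u
    aColour∈ u = subst (λ w → aColour u ∈ aLists w) (splitAt-join s (suc p) u) (c∈ (inj₂ (inj₁ (join s (suc p) u))))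

    aColour-Used : ∀ u → Used (aColour u)
    aColour-Used u = inj₂ (join s (suc p) u , refl)

    aColour∉cliqueColours : ∀ u → All (aColour u ≢_) cliqueColours
    aColour∉cliqueColours u = tabulate⁺ λ i eq → proper (inj₁ i) (inj₂ (inj₁ (join s (suc p) u))) tt (sym eq)

    usedCombination : ∀ {U} k → Unique U → All (_∈ core) U → All Used U → k ≤ length U →
                      ∃ λ S → S ∈ combinations k core × All Used S
    usedCombination k uU U⊆core usedU k≤|U| =
      let S , S∈ , S⊆U = combinations-complete core k uU (All.lookup U⊆core) k≤|U|
      in S , S∈ , All.tabulate (All.lookup usedU ∘ S⊆U)

    c₀ : ℕ
    c₀ = aColour (inj₂ zero)

    j₀ : Fin p
    j₀ = fromℕ< (m<n*o⇒m/o<n (subst (c₀ <_) (trans N≡qp (*-comm q p)) (∈-upTo⁻ (aColour∈ (inj₂ zero)))))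

    e : ℕ
    e = aColour (inj₂ (suc j₀))

    cliqueAndC₀ : List ℕ
    cliqueAndC₀ = c₀ ∷ cliqueColours

    cliqueAndC₀-unique : Unique cliqueAndC₀
    cliqueAndC₀-unique = aColour∉cliqueColours (inj₂ zero) ∷ cliqueColours-unique

    cliqueAndC₀⊆core : All (_∈ core) cliqueAndC₀
    cliqueAndC₀⊆core = aColour∈ (inj₂ zero) ∷ tabulate⁺ (c∈ ∘ inj₁)

    cliqueAndC₀-Used : All Used cliqueAndC₀
    cliqueAndC₀-Used = aColour-Used (inj₂ zero) ∷ tabulate⁺ (λ i → inj₁ (i , refl))

    length-cliqueAndC₀ : length cliqueAndC₀ ≡ suc m
    length-cliqueAndC₀ = cong suc (length-tabulate (c ∘ inj₁))

    -- c₀ lies in block j₀ of the core, which the list of the vertex coloured e avoids.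
    usedHead : ∃ λ H → H ∈ heads × All Used H
    usedHead with ∈-avoiding⁻ (aColour∈ (inj₂ (suc j₀)))
    ... | inj₁ e∈extras =
      let S , S∈ , usedS = usedCombination (suc m) cliqueAndC₀-unique cliqueAndC₀⊆core cliqueAndC₀-Used
                             (≤-reflexive (sym length-cliqueAndC₀))
      in S ++ [ e ] ,
         ∈-++⁺ʳ _ (∈-cartesianProductWith⁺ _ S∈ e∈extras) ,
         ++⁺ usedS (aColour-Used (inj₂ (suc j₀)) ∷ [])
    ... | inj₂ (e∈core , e/q≢j₀) =
      let S , S∈ , usedS = usedCombination (suc m + 1)
                             ((e≢c₀ ∷ aColour∉cliqueColours (inj₂ (suc j₀))) ∷ cliqueAndC₀-unique)
                             (e∈core ∷ cliqueAndC₀⊆core)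
                             (aColour-Used (inj₂ (suc j₀)) ∷ cliqueAndC₀-Used)
                             (≤-reflexive (trans (+-comm (suc m) 1) (cong suc (sym length-cliqueAndC₀))))
      in S , ∈-++⁺ˡ S∈ , usedS
      where
      e≢c₀ : e ≢ c₀
      e≢c₀ e≡c₀ = e/q≢j₀ (trans (cong (_/ q) e≡c₀) (sym (toℕ-fromℕ< _)))

    usedBList : ∃ λ D → D ∈ bLists × All Used D
    usedBList =
      let H , H∈ , usedH = usedHead
      in H ++ tabulate (aColour ∘ inj₁) ,
         ∈-cartesianProductWith⁺ (λ T H → H ++ T)
           (transversals-complete (aColour ∘ inj₁) (aColour∈ ∘ inj₁)) H∈ ,
         ++⁺ usedH (tabulate⁺ (aColour-Used ∘ inj₁))

  not-choosable : ∀ b → N ^ s * (N C (suc m + 1) + (N C suc m) * q) ≤ b → ¬ Choosable (G b) N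
  not-choosable b M≤b choosable
    with c , c∈ , proper ← choosable lists (proj₁ ∘ lists-Admissible) (proj₂ ∘ lists-Admissible) =
    let open Colouring c c∈ proper
        D , D∈ , usedD = usedBList
        k , lists≡D    = bLists-realised (subst (_≤ b) (sym length-bLists) M≤b) D∈
    in B-blocked k (subst (All Used) (sym lists≡D) usedD)

theorem8 : (s l a q b : ℕ) → 2 ≤ l → s + 2 < a →
    l + s + 1 ≡ q * (a ∸ s ∸ 1) →
    a ≤ b →
    (l + s + 1) ^ s * ((l + s + 1) C (l + 1) + ((l + s + 1) C l) * q) ≤ b →
    ∀ n → GapAtMost s n a b → l ≤ n
theorem8 s zero    a q b () _ _ _ _ _ _
theorem8 s (suc m) a q b _ s+2<a N≡qp _ M≤b n gap =
  ≮⇒≥ λ { (s≤s n≤m) → not-choosable b M≤b (choosable n≤m) }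
  where
  open BadListAssignment m s (a ∸ s ∸ 1) q N≡qp

  a≡s+1+p : s + suc (a ∸ s ∸ 1) ≡ a
  a≡s+1+p = m+[1+[n∸m∸1]]≡n (<-trans (m<m+n s z<s) s+2<a)

  choosable : n ≤ m → Choosable (G b) N
  choosable n≤m = subst (λ a′ → Choosable (K m ∨G KBip a′ b) N) (sym a≡s+1+p)
    (Choosable-mono (≤-reflexive (solve 2 (λ m s → m :+ (con 2 :+ s) := con 1 :+ m :+ s :+ con 1) refl m s))
      (Choosable-K-≤‴ (KBip a b) (≤⇒≤‴ n≤m) (GapAtMost⇒Choosable gap)))
    where open +-*-Solver
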